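{- Let $G$ be a finite group, $H$ a subgroup, and $S\subseteq G\setminus H$ a set of representatives of pairwise distinct double cosets $HsH$ with $\langle H,S\rangle=G$. Suppose the Cayley coset digraph $\mathcal{G}=\mathcal{G}(G,H,S)$, with $n$ vertices and vertex connectivity $\kappa$, is not complete and has an atom of size at most $(n-\kappa)/2$. Let $A_0$ be the atom containing the vertex $H$, $S_0=\{s\in S: s\in\bigcup A_0\}$ and $S_1=S\setminus S_0$. Then $$|N(A_0)|=\Big|\big(\textstyle\bigcup A_0\big)S_1H/H\Big|\geq\max(|A_0|,d_{S_1}),$$ and $|N(A_0)|$ is a multiple of $|A_0|$.
   Context: The Cayley coset digraph $\mathcal{G}(G,H,S)$ has vertex set $G/H$ of left cosets of $H$, and $(gH,g'H)$ is an edge iff $gHs\cap g'H\neq\emptyset$ for some $s\in S$. For $s\in S$, $d_s=|HsH/H|$ is the number of left cosets of $H$ in $HsH$, and $d_{S'}=\sum_{s\in S'}d_s$ for $S'\subseteq S$. For a union $F$ of left cosets of $H$, $F/H$ denotes the set of left cosets of $H$ contained in $F$; $\bigcup A_0$ is the union in $G$ of the cosets in $A_0$. For $A\subseteq V$, $N(A)$ is the set of vertices outside $A$ that are heads of edges with tail in $A$; $A$ is a part if $V\setminus(A\cup N(A))\neq\emptyset$. The vertex connectivity $\kappa$ is the smallest number of vertices whose removal leaves a digraph that is not strongly connected. An atom is a part $A$ with $|N(A)|=\kappa$ of minimum size among such parts; under the hypotheses atoms partition the vertex set. -}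

module Defs where

open import Data.Nat using (ℕ; zero; suc; _+_; _*_; _/_; _≤_; _⊔_)
open import Data.Bool using (Bool; true; false; if_then_else_)
open import Data.Fin using (Fin; _≟_)
open import Data.Fin.Properties using (any?)
open import Data.Fin.Subset using (Subset; _∈_; _∉_; ∣_∣; ⊤; _∩_; ∁)
import Relation.Nullary.Decidable
open import Data.Fin.Subset.Properties using (_∈?_)
open import Data.Vec using (tabulate; zipWith; allFin)
import Data.Vec as Vec
open import Data.Product using (Σ; ∃; _×_; _,_)
open import Relation.Nullary using (¬_; Dec; does)
open import Relation.Nullary.Decidable using (_×-dec_)
open import Relation.Unary using (Pred; Decidable)
open import Relation.Binary.PropositionalEquality using (_≡_)
open import Algebra.Structures using (IsGroup)

record FinGroup (m : ℕ) : Set where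
  infixl 7 _∙_
  field
    _∙_     : Fin m → Fin m → Fin m
    ε       : Fin m
    _⁻¹     : Fin m → Fin m
    isGroup : IsGroup _≡_ _∙_ ε _⁻¹

toSub : ∀ {m ℓ} {P : Pred (Fin m) ℓ} → Decidable P → Subset m
toSub P? = tabulate (λ x → does (P? x))

-- Division with the convention x // 0 = 0 (only used with |H| ≥ 1).
_//_ : ℕ → ℕ → ℕ
a // zero  = 0
a // suc k = a / suc k

module _ {m : ℕ} (G : FinGroup m) where
  open FinGroup G

  IsSubgroup : Subset m → Set
  IsSubgroup H = (ε ∈ H)
    × (∀ {x y} → x ∈ H → y ∈ H → x ∙ y ∈ H)
    × (∀ {x} → x ∈ H → x ⁻¹ ∈ H)

  data Gen (H S : Subset m) : Fin m → Set where
    genH   : ∀ {x} → x ∈ H → Gen H S x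
    genS   : ∀ {x} → x ∈ S → Gen H S x
    genε   : Gen H S ε
    genMul : ∀ {x y} → Gen H S x → Gen H S y → Gen H S (x ∙ y)
    genInv : ∀ {x} → Gen H S x → Gen H S (x ⁻¹)

  DC : Subset m → Fin m → Subset m
  DC H s = toSub (λ x → any? λ h → (h ∈? H) ×-dec any? λ h' → (h' ∈? H) ×-dec ((h ∙ s) ∙ h' ≟ x))

  -- Vertices of the Cayley coset digraph are left cosets gH; a vertex is
  -- represented by any element g of it, and a set of vertices A ⊆ G/H is
  -- represented by the union ⋃A ⊆ G (an H-saturated subset of G).

  Saturated : Subset m → Subset m → Set
  Saturated H X = ∀ {g h} → g ∈ X → h ∈ H → g ∙ h ∈ X

  #V : Subset m → Subset m → ℕ
  #V H X = ∣ X ∣ // ∣ H ∣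

  Edge : (H S : Subset m) → Fin m → Fin m → Set
  Edge H S g g' = ∃ λ s → s ∈ S × ∃ λ h → h ∈ H × ∃ λ h' → h' ∈ H × (g ∙ h) ∙ s ≡ g' ∙ h'

  edge? : (H S : Subset m) → ∀ g g' → Dec (Edge H S g g')
  edge? H S g g' = any? λ s → (s ∈? S) ×-dec any? λ h → (h ∈? H) ×-dec
                   any? λ h' → (h' ∈? H) ×-dec ((g ∙ h) ∙ s ≟ g' ∙ h')

  N : (H S A : Subset m) → Subset m
  N H S A = toSub (λ x → Relation.Nullary.Decidable.¬? (x ∈? A) ×-dec
                         any? λ g → (g ∈? A) ×-dec edge? H S g x)

  Complete : (H S : Subset m) → Set
  Complete H S = ∀ g g' → (g ⁻¹) ∙ g' ∉ H → Edge H S g g'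

  data Reach (H S T : Subset m) : Fin m → Fin m → Set where
    same : ∀ {u v} → (u ⁻¹) ∙ v ∈ H → Reach H S T u v
    step : ∀ {u w v} → Edge H S u w → w ∉ T → Reach H S T w v → Reach H S T u v

  Disconnects : (H S T : Subset m) → Set
  Disconnects H S T = ∃ λ u → ∃ λ v → u ∉ T × v ∉ T × ¬ Reach H S T u v

  IsConnectivity : (H S : Subset m) → ℕ → Set
  IsConnectivity H S κ =
    (∃ λ T → Saturated H T × Disconnects H S T × #V H T ≡ κ)
    × (∀ T → Saturated H T → Disconnects H S T → κ ≤ #V H T)

  IsPart : (H S A : Subset m) → Set
  IsPart H S A = Saturated H A × ∃ λ x → x ∉ A × x ∉ N H S A

  IsAtom : (H S : Subset m) → ℕ → Subset m → Set
  IsAtom H S κ A = IsPart H S A × #V H (N H S A) ≡ κ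
    × (∀ B → IsPart H S B → #V H (N H S B) ≡ κ → #V H A ≤ #V H B)

  ProdSH : (H S' A : Subset m) → Subset m
  ProdSH H S' A = toSub (λ x → any? λ a → (a ∈? A) ×-dec any? λ s → (s ∈? S') ×-dec
                               any? λ h → (h ∈? H) ×-dec ((a ∙ s) ∙ h ≟ x))

  d : Subset m → Fin m → ℕ
  d H s = #V H (DC H s)

  dSum : Subset m → Subset m → ℕ
  dSum H S' = Vec.sum (zipWith (λ b s → if b then d H s else 0) S' (allFin m))

-- Vertex sets are handled through their H-saturated unions in G, so sizes are counted in
-- elements, |X| = #V X · |H|. Since one atom has at most (n − κ)/2 vertices, all atoms do, and
-- the intersection argument for atoms applies to the atom K containing the identity: if B has
-- |B| ≤ |K| and |N(B)| ≤ κ and meets K, then either K ∪ B is a part, and submodularity of |N|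
-- bounds |N(K ∩ B)| by κ, so K ⊆ B by minimality of K, or every vertex lies in K ∪ N(K) ∪ B ∪ N(B),
-- and counting against |G| makes K ∩ B empty. Left translation is an automorphism of the
-- digraph, so B = kK for k ∈ K shows that K is a subgroup containing H. Hence N(K) = K S₁ H,
-- K acts freely on N(K) by left multiplication, so |K| divides |N(K)| = κ, and the double
-- cosets H s H (s ∈ S₁) are disjoint subsets of N(K), so d_{S₁} ≤ κ.

module Submission where

open import Defs
open import Data.Nat using (ℕ; _*_; _∸_; _≤_; _⊔_)
open import Data.Nat.Divisibility using (_∣_)
open import Data.Fin using (Fin)
open import Data.Fin.Subset using (Subset; _∈_; _∉_; ⊤; _∩_; ∁)
open import Data.Product using (Σ; ∃; _×_)
open import Relation.Nullary using (¬_)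
open import Relation.Binary.PropositionalEquality using (_≡_)

open import Data.Nat using (zero; suc; _+_; _<_; z≤n; z<s; NonZero; >-nonZero)
open import Data.Nat.Properties hiding (suc-injective; 0≢1+n; _≟_)
open import Data.Nat.Divisibility using (∣m∣n⇒∣m+n; ∣-refl; _∣0; *-cancelʳ-∣; ∣⇒≤)
open import Data.Nat.DivMod using (m/n*n≡m; /-monoˡ-≤)
open import Data.Bool using (Bool; true; false; if_then_else_)
open import Data.Vec as Vec using (Vec; _∷_; []; here; there; tabulate; zipWith)
open import Data.Vec.Properties using (lookup∘tabulate; []=⇒lookup; lookup⇒[]=)
open import Data.Fin using (zero; suc; _≟_)
open import Data.Fin.Properties using (any?; suc-injective; 0≢1+n)
open import Data.Fin.Subset using (∣_∣; _∪_; _⊆_; Empty; _-_)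
open import Data.Fin.Subset.Properties
open import Data.Product using (_,_; proj₁; proj₂)
open import Data.Sum using (_⊎_; inj₁; inj₂)
import Data.Sum
open import Data.Empty using (⊥; ⊥-elim)
open import Relation.Nullary using (Dec; yes; no; does; contradiction)
open import Relation.Nullary.Decidable using (_×-dec_; ¬?)
open import Relation.Unary using (Pred; Decidable)
open import Relation.Binary.PropositionalEquality
  using (refl; sym; trans; cong; cong₂; subst; subst₂; module ≡-Reasoning)
open import Algebra.Bundles using (Group)
open import Algebra.Structures using (IsGroup)
import Algebra.Properties.Group as GroupProperties
open import Function using (_∘_; id)
open import Data.Nat.Tactic.RingSolver using (solve-∀)

∣p∣+∣q∣≡∣p∪q∣+∣p∩q∣ : ∀ {n} (p q : Subset n) → ∣ p ∣ + ∣ q ∣ ≡ ∣ p ∪ q ∣ + ∣ p ∩ q ∣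
∣p∣+∣q∣≡∣p∪q∣+∣p∩q∣ []          []          = refl
∣p∣+∣q∣≡∣p∪q∣+∣p∩q∣ (true ∷ p)  (true ∷ q)  =
  cong suc (trans (+-suc ∣ p ∣ ∣ q ∣) (trans (cong suc (∣p∣+∣q∣≡∣p∪q∣+∣p∩q∣ p q)) (sym (+-suc _ _))))
∣p∣+∣q∣≡∣p∪q∣+∣p∩q∣ (true ∷ p)  (false ∷ q) = cong suc (∣p∣+∣q∣≡∣p∪q∣+∣p∩q∣ p q)
∣p∣+∣q∣≡∣p∪q∣+∣p∩q∣ (false ∷ p) (true ∷ q)  = trans (+-suc ∣ p ∣ ∣ q ∣) (cong suc (∣p∣+∣q∣≡∣p∪q∣+∣p∩q∣ p q))
∣p∣+∣q∣≡∣p∪q∣+∣p∩q∣ (false ∷ p) (false ∷ q) = ∣p∣+∣q∣≡∣p∪q∣+∣p∩q∣ p q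

∣p∣≡∣p∩q∣+∣p∩∁q∣ : ∀ {n} (p q : Subset n) → ∣ p ∣ ≡ ∣ p ∩ q ∣ + ∣ p ∩ ∁ q ∣
∣p∣≡∣p∩q∣+∣p∩∁q∣ []          []          = refl
∣p∣≡∣p∩q∣+∣p∩∁q∣ (true ∷ p)  (true ∷ q)  = cong suc (∣p∣≡∣p∩q∣+∣p∩∁q∣ p q)
∣p∣≡∣p∩q∣+∣p∩∁q∣ (true ∷ p)  (false ∷ q) = trans (cong suc (∣p∣≡∣p∩q∣+∣p∩∁q∣ p q)) (sym (+-suc _ _))
∣p∣≡∣p∩q∣+∣p∩∁q∣ (false ∷ p) (true ∷ q)  = ∣p∣≡∣p∩q∣+∣p∩∁q∣ p q
∣p∣≡∣p∩q∣+∣p∩∁q∣ (false ∷ p) (false ∷ q) = ∣p∣≡∣p∩q∣+∣p∩∁q∣ p q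

∣p∣+∣∁p∣≡n : ∀ {n} (p : Subset n) → ∣ p ∣ + ∣ ∁ p ∣ ≡ n
∣p∣+∣∁p∣≡n []          = refl
∣p∣+∣∁p∣≡n (true ∷ p)  = cong suc (∣p∣+∣∁p∣≡n p)
∣p∣+∣∁p∣≡n (false ∷ p) = trans (+-suc _ _) (cong suc (∣p∣+∣∁p∣≡n p))

Empty⇒∣p∣≡0 : ∀ {n} {p : Subset n} → Empty p → ∣ p ∣ ≡ 0
Empty⇒∣p∣≡0 {n} p-empty = trans (cong ∣_∣ (Empty-unique p-empty)) (∣⊥∣≡0 n)

x∈p⇒0<∣p∣ : ∀ {n} {p : Subset n} {x} → x ∈ p → 0 < ∣ p ∣
x∈p⇒0<∣p∣ x∈p = <-≤-trans z<s (x∈p⇒∣p-x∣<∣p∣ x∈p)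

p⊆q∪r⇒∣p∣≤∣q∣+∣r∣ : ∀ {n} (p q r : Subset n) → p ⊆ q ∪ r → ∣ p ∣ ≤ ∣ q ∣ + ∣ r ∣
p⊆q∪r⇒∣p∣≤∣q∣+∣r∣ p q r p⊆q∪r = begin
  ∣ p ∣                 ≤⟨ p⊆q⇒∣p∣≤∣q∣ p⊆q∪r ⟩
  ∣ q ∪ r ∣             ≤⟨ m≤m+n _ _ ⟩
  ∣ q ∪ r ∣ + ∣ q ∩ r ∣ ≡⟨ ∣p∣+∣q∣≡∣p∪q∣+∣p∩q∣ q r ⟨
  ∣ q ∣ + ∣ r ∣         ∎
  where open ≤-Reasoning

Empty[p∩q]⇒∣p∣+∣q∣≤∣r∣ : ∀ {n} (p q r : Subset n) → Empty (p ∩ q) → p ∪ q ⊆ r → ∣ p ∣ + ∣ q ∣ ≤ ∣ r ∣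
Empty[p∩q]⇒∣p∣+∣q∣≤∣r∣ p q r disjoint p∪q⊆r = begin
  ∣ p ∣ + ∣ q ∣         ≡⟨ ∣p∣+∣q∣≡∣p∪q∣+∣p∩q∣ p q ⟩
  ∣ p ∪ q ∣ + ∣ p ∩ q ∣ ≡⟨ cong (∣ p ∪ q ∣ +_) (Empty⇒∣p∣≡0 disjoint) ⟩
  ∣ p ∪ q ∣ + 0         ≡⟨ +-identityʳ _ ⟩
  ∣ p ∪ q ∣             ≤⟨ p⊆q⇒∣p∣≤∣q∣ p∪q⊆r ⟩
  ∣ r ∣                 ∎
  where open ≤-Reasoning

∣p∣≤∣p∩q∣⇒p⊆q : ∀ {n} {p q : Subset n} → ∣ p ∣ ≤ ∣ p ∩ q ∣ → p ⊆ q
∣p∣≤∣p∩q∣⇒p⊆q {p = p} {q} ∣p∣≤∣p∩q∣ {x} x∈p with x ∈? q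
... | yes x∈q = x∈q
... | no  x∉q = contradiction ∣p∣≤∣p∩q∣ (<⇒≱ (begin-strict
  ∣ p ∩ q ∣               <⟨ m<m+n _ (x∈p⇒0<∣p∣ (x∈p∩q⁺ (x∈p , x∉p⇒x∈∁p x∉q))) ⟩
  ∣ p ∩ q ∣ + ∣ p ∩ ∁ q ∣ ≡⟨ ∣p∣≡∣p∩q∣+∣p∩∁q∣ p q ⟨
  ∣ p ∣                   ∎))
  where open ≤-Reasoning

injection⇒∣p∣≤∣q∣ : ∀ {k n} {p : Subset k} {q : Subset n} (f : Fin k → Fin n) →
  (∀ {x} → x ∈ p → f x ∈ q) → (∀ {x y} → x ∈ p → y ∈ p → f x ≡ f y → x ≡ y) → ∣ p ∣ ≤ ∣ q ∣
injection⇒∣p∣≤∣q∣ {p = []}        f _ _ = z≤n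
injection⇒∣p∣≤∣q∣ {p = false ∷ p} f maps inj =
  injection⇒∣p∣≤∣q∣ (f ∘ suc) (maps ∘ there) (λ x∈ y∈ eq → suc-injective (inj (there x∈) (there y∈) eq))
injection⇒∣p∣≤∣q∣ {p = true ∷ p} {q} f maps inj = begin-strict
  ∣ p ∣           ≤⟨ injection⇒∣p∣≤∣q∣ {q = q - f zero} (f ∘ suc) maps′
                       (λ x∈ y∈ eq → suc-injective (inj (there x∈) (there y∈) eq)) ⟩
  ∣ q - f zero ∣  <⟨ x∈p⇒∣p-x∣<∣p∣ (maps here) ⟩
  ∣ q ∣           ∎
  where
  open ≤-Reasoning
  maps′ : ∀ {x} → x ∈ p → f (suc x) ∈ q - f zero
  maps′ x∈ = x∈p∧x≢y⇒x∈p-y (maps (there x∈)) (λ eq → 0≢1+n (inj here (there x∈) (sym eq)))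

∈toSub⁺ : ∀ {n ℓ} {P : Pred (Fin n) ℓ} (P? : Decidable P) {x} → P x → x ∈ toSub P?
∈toSub⁺ {P = P} P? {x} px = lookup⇒[]= x _ (trans (lookup∘tabulate _ x) (does-true (P? x)))
  where
  does-true : (d : Dec (P x)) → does d ≡ true
  does-true (yes _)  = refl
  does-true (no ¬px) = contradiction px ¬px

∈toSub⁻ : ∀ {n ℓ} {P : Pred (Fin n) ℓ} (P? : Decidable P) {x} → x ∈ toSub P? → P x
∈toSub⁻ {P = P} P? {x} x∈ = witness (P? x) (trans (sym (lookup∘tabulate _ x)) ([]=⇒lookup x∈))
  where
  witness : (d : Dec (P x)) → does d ≡ true → P x
  witness (yes px) _ = px

n≡n//m*m : ∀ {m n} → .{{NonZero m}} → m ∣ n → n ≡ (n // m) * m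
n≡n//m*m {suc m} m∣n = sym (m/n*n≡m m∣n)

//-monoˡ-≤ : ∀ {m n} o → m ≤ n → m // o ≤ n // o
//-monoˡ-≤ zero    _   = z≤n
//-monoˡ-≤ (suc o) m≤n = /-monoˡ-≤ (suc o) m≤n

module FinGroupProperties {m : ℕ} (G : FinGroup m) where
  open FinGroup G public
  open IsGroup isGroup public using (assoc; identityˡ; identityʳ; inverseˡ; inverseʳ)

  group : Group _ _
  group = record { isGroup = isGroup }

  open GroupProperties group public
    using (⁻¹-involutive; ⁻¹-injective; ⁻¹-anti-homo-∙; ∙-cancelˡ; ∙-cancelʳ;
           \\-leftDividesˡ; \\-leftDividesʳ; //-rightDividesˡ; //-rightDividesʳ)

  _◃_ : Fin m → Subset m → Subset m
  g ◃ A = toSub (λ x → g ⁻¹ ∙ x ∈? A)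

  _▹_ : Subset m → Fin m → Subset m
  A ▹ g = toSub (λ x → x ∙ g ⁻¹ ∈? A)

  _⁻¹ˢ : Subset m → Subset m
  A ⁻¹ˢ = toSub (λ x → x ⁻¹ ∈? A)

  module _ {g x : Fin m} {A : Subset m} where
    ∈◃⁺ : g ⁻¹ ∙ x ∈ A → x ∈ g ◃ A
    ∈◃⁺ = ∈toSub⁺ (λ x → g ⁻¹ ∙ x ∈? A)
    ∈◃⁻ : x ∈ g ◃ A → g ⁻¹ ∙ x ∈ A
    ∈◃⁻ = ∈toSub⁻ (λ x → g ⁻¹ ∙ x ∈? A)
    ∈▹⁺ : x ∙ g ⁻¹ ∈ A → x ∈ A ▹ g
    ∈▹⁺ = ∈toSub⁺ (λ x → x ∙ g ⁻¹ ∈? A)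
    ∈▹⁻ : x ∈ A ▹ g → x ∙ g ⁻¹ ∈ A
    ∈▹⁻ = ∈toSub⁻ (λ x → x ∙ g ⁻¹ ∈? A)

  module _ {x : Fin m} {A : Subset m} where
    ∈⁻¹ˢ⁺ : x ⁻¹ ∈ A → x ∈ A ⁻¹ˢ
    ∈⁻¹ˢ⁺ = ∈toSub⁺ (λ x → x ⁻¹ ∈? A)
    ∈⁻¹ˢ⁻ : x ∈ A ⁻¹ˢ → x ⁻¹ ∈ A
    ∈⁻¹ˢ⁻ = ∈toSub⁻ (λ x → x ⁻¹ ∈? A)

  ∣g◃A∣≡∣A∣ : ∀ g A → ∣ g ◃ A ∣ ≡ ∣ A ∣
  ∣g◃A∣≡∣A∣ g A = ≤-antisym
    (injection⇒∣p∣≤∣q∣ (g ⁻¹ ∙_) ∈◃⁻ (λ _ _ → ∙-cancelˡ _ _ _))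
    (injection⇒∣p∣≤∣q∣ (g ∙_) (λ {x} x∈ → ∈◃⁺ (subst (_∈ A) (sym (\\-leftDividesʳ g x)) x∈))
                              (λ _ _ → ∙-cancelˡ _ _ _))

  ∣A▹g∣≡∣A∣ : ∀ A g → ∣ A ▹ g ∣ ≡ ∣ A ∣
  ∣A▹g∣≡∣A∣ A g = ≤-antisym
    (injection⇒∣p∣≤∣q∣ (_∙ g ⁻¹) ∈▹⁻ (λ _ _ → ∙-cancelʳ _ _ _))
    (injection⇒∣p∣≤∣q∣ (_∙ g) (λ {x} x∈ → ∈▹⁺ (subst (_∈ A) (sym (//-rightDividesʳ g x)) x∈))
                              (λ _ _ → ∙-cancelʳ _ _ _))

  ∣A⁻¹ˢ∣≡∣A∣ : ∀ A → ∣ A ⁻¹ˢ ∣ ≡ ∣ A ∣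
  ∣A⁻¹ˢ∣≡∣A∣ A = ≤-antisym
    (injection⇒∣p∣≤∣q∣ _⁻¹ ∈⁻¹ˢ⁻ (λ _ _ → ⁻¹-injective))
    (injection⇒∣p∣≤∣q∣ _⁻¹ (λ {x} x∈ → ∈⁻¹ˢ⁺ (subst (_∈ A) (sym (⁻¹-involutive x)) x∈))
                           (λ _ _ → ⁻¹-injective))

  Gen⊆ : ∀ {H S K} → IsSubgroup G K → H ⊆ K → S ⊆ K → ∀ {g} → Gen G H S g → g ∈ K
  Gen⊆ K≤G H⊆K S⊆K (genH g∈H)   = H⊆K g∈H
  Gen⊆ K≤G H⊆K S⊆K (genS g∈S)   = S⊆K g∈S
  Gen⊆ K≤G H⊆K S⊆K genε         = proj₁ K≤G
  Gen⊆ K≤G H⊆K S⊆K (genMul x y) = proj₁ (proj₂ K≤G) (Gen⊆ K≤G H⊆K S⊆K x) (Gen⊆ K≤G H⊆K S⊆K y)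
  Gen⊆ K≤G H⊆K S⊆K (genInv x)   = proj₂ (proj₂ K≤G) (Gen⊆ K≤G H⊆K S⊆K x)

  module _ {K : Subset m} (K≤G : IsSubgroup G K) where
    private
      ε∈K : ε ∈ K
      ε∈K = proj₁ K≤G
      ∙-closed : ∀ {x y} → x ∈ K → y ∈ K → x ∙ y ∈ K
      ∙-closed = proj₁ (proj₂ K≤G)
      ⁻¹-closed : ∀ {x} → x ∈ K → x ⁻¹ ∈ K
      ⁻¹-closed = proj₂ (proj₂ K≤G)

    ∣K∣∣∣X∣⇐KX⊆X : ∀ X → (∀ {k x} → k ∈ K → x ∈ X → k ∙ x ∈ X) → ∣ K ∣ ∣ ∣ X ∣
    ∣K∣∣∣X∣⇐KX⊆X X = go ∣ X ∣ X ≤-refl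
      where
      -- X is the disjoint union of the coset Kx of some x ∈ X and the K-invariant rest
      go : ∀ fuel X → ∣ X ∣ ≤ fuel → (∀ {k x} → k ∈ K → x ∈ X → k ∙ x ∈ X) → ∣ K ∣ ∣ ∣ X ∣
      go fuel X _ _ with nonempty? X
      go fuel X _ _ | no X-empty =
        subst (∣ K ∣ ∣_) (sym (Empty⇒∣p∣≡0 X-empty)) (∣ K ∣ ∣0)
      go zero X ∣X∣≤0 _ | yes (x , x∈X) =
        contradiction ∣X∣≤0 (<⇒≱ (x∈p⇒0<∣p∣ x∈X))
      go (suc fuel) X ∣X∣≤fuel KX⊆X | yes (x , x∈X) =
        subst (∣ K ∣ ∣_) (sym ∣X∣≡∣Kx∣+∣X∖Kx∣)
          (∣m∣n⇒∣m+n (subst (∣ K ∣ ∣_) (sym (∣A▹g∣≡∣A∣ K x)) ∣-refl)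
                     (go fuel (X ∩ ∁ (K ▹ x)) ∣X∖Kx∣≤fuel K[X∖Kx]⊆X∖Kx))
        where
        x∈Kx : x ∈ K ▹ x
        x∈Kx = ∈▹⁺ (subst (_∈ K) (sym (inverseʳ x)) ε∈K)
        Kx⊆X : K ▹ x ⊆ X
        Kx⊆X {y} y∈Kx = subst (_∈ X) (//-rightDividesˡ x y) (KX⊆X (∈▹⁻ y∈Kx) x∈X)
        ∣X∣≡∣Kx∣+∣X∖Kx∣ : ∣ X ∣ ≡ ∣ K ▹ x ∣ + ∣ X ∩ ∁ (K ▹ x) ∣
        ∣X∣≡∣Kx∣+∣X∖Kx∣ = trans (∣p∣≡∣p∩q∣+∣p∩∁q∣ X (K ▹ x))
          (cong (_+ ∣ X ∩ ∁ (K ▹ x) ∣) (cong ∣_∣ (⊆-antisym (p∩q⊆q X _) (λ y∈ → x∈p∩q⁺ (Kx⊆X y∈ , y∈)))))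
        ∣X∖Kx∣≤fuel : ∣ X ∩ ∁ (K ▹ x) ∣ ≤ fuel
        ∣X∖Kx∣≤fuel = ≤-pred (begin-strict
          ∣ X ∩ ∁ (K ▹ x) ∣            <⟨ m<n+m _ (x∈p⇒0<∣p∣ x∈Kx) ⟩
          ∣ K ▹ x ∣ + ∣ X ∩ ∁ (K ▹ x) ∣ ≡⟨ ∣X∣≡∣Kx∣+∣X∖Kx∣ ⟨
          ∣ X ∣                         ≤⟨ ∣X∣≤fuel ⟩
          suc fuel                      ∎)
          where open ≤-Reasoning
        K[X∖Kx]⊆X∖Kx : ∀ {k y} → k ∈ K → y ∈ X ∩ ∁ (K ▹ x) → k ∙ y ∈ X ∩ ∁ (K ▹ x)
        K[X∖Kx]⊆X∖Kx {k} {y} k∈K y∈ with x∈p∩q⁻ X _ y∈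
        ... | y∈X , y∉Kx = x∈p∩q⁺ (KX⊆X k∈K y∈X , x∉p⇒x∈∁p λ ky∈Kx →
          x∈∁p⇒x∉p y∉Kx (∈▹⁺ (subst (_∈ K) (trans (sym (assoc _ _ _)) (cong (_∙ x ⁻¹) (\\-leftDividesʳ k y)))
                                           (∙-closed (⁻¹-closed k∈K) (∈▹⁻ ky∈Kx)))))

    ∣K∣∣∣X∣⇐XK⊆X : ∀ X → (∀ {x k} → x ∈ X → k ∈ K → x ∙ k ∈ X) → ∣ K ∣ ∣ ∣ X ∣
    ∣K∣∣∣X∣⇐XK⊆X X XK⊆X = subst (∣ K ∣ ∣_) (∣A⁻¹ˢ∣≡∣A∣ X) (∣K∣∣∣X∣⇐KX⊆X (X ⁻¹ˢ) KX⁻¹⊆X⁻¹)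
      where
      KX⁻¹⊆X⁻¹ : ∀ {k x} → k ∈ K → x ∈ X ⁻¹ˢ → k ∙ x ∈ X ⁻¹ˢ
      KX⁻¹⊆X⁻¹ {k} {x} k∈K x∈ =
        ∈⁻¹ˢ⁺ (subst (_∈ X) (sym (⁻¹-anti-homo-∙ k x)) (XK⊆X (∈⁻¹ˢ⁻ x∈) (⁻¹-closed k∈K)))

module CosetDigraph {m : ℕ} (G : FinGroup m) (H S : Subset m) (H≤G : IsSubgroup G H) where
  open FinGroupProperties G

  private
    ε∈H : ε ∈ H
    ε∈H = proj₁ H≤G
    H-∙-closed : ∀ {x y} → x ∈ H → y ∈ H → x ∙ y ∈ H
    H-∙-closed = proj₁ (proj₂ H≤G)
    H-⁻¹-closed : ∀ {x} → x ∈ H → x ⁻¹ ∈ H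
    H-⁻¹-closed = proj₂ (proj₂ H≤G)

  instance
    ∣H∣-nonZero : NonZero ∣ H ∣
    ∣H∣-nonZero = >-nonZero (x∈p⇒0<∣p∣ ε∈H)

  ∣X∣≡#V[X]*∣H∣ : ∀ {X} → Saturated G H X → ∣ X ∣ ≡ #V G H X * ∣ H ∣
  ∣X∣≡#V[X]*∣H∣ {X} X-sat = n≡n//m*m (∣K∣∣∣X∣⇐XK⊆X H≤G X X-sat)

  #V-mono : ∀ {X Y} → X ⊆ Y → #V G H X ≤ #V G H Y
  #V-mono X⊆Y = //-monoˡ-≤ ∣ H ∣ (p⊆q⇒∣p∣≤∣q∣ X⊆Y)

  module _ {A : Subset m} {x : Fin m} where
    ∈N⁺ : ∀ {g} → x ∉ A → g ∈ A → Edge G H S g x → x ∈ N G H S A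
    ∈N⁺ x∉A g∈A e = ∈toSub⁺ (λ x → ¬? (x ∈? A) ×-dec any? λ g → (g ∈? A) ×-dec edge? G H S g x)
                            (x∉A , _ , g∈A , e)

    ∈N⁻ : x ∈ N G H S A → x ∉ A × ∃ λ g → g ∈ A × Edge G H S g x
    ∈N⁻ = ∈toSub⁻ (λ x → ¬? (x ∈? A) ×-dec any? λ g → (g ∈? A) ×-dec edge? G H S g x)

  Edge-translate : ∀ k {g x} → Edge G H S g x → Edge G H S (k ∙ g) (k ∙ x)
  Edge-translate k {g} {x} (s , s∈S , h , h∈H , h′ , h′∈H , gh∙s≡xh′) = s , s∈S , h , h∈H , h′ , h′∈H , (begin
    ((k ∙ g) ∙ h) ∙ s ≡⟨ cong (_∙ s) (assoc k g h) ⟩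
    (k ∙ (g ∙ h)) ∙ s ≡⟨ assoc k (g ∙ h) s ⟩
    k ∙ ((g ∙ h) ∙ s) ≡⟨ cong (k ∙_) gh∙s≡xh′ ⟩
    k ∙ (x ∙ h′)      ≡⟨ assoc k x h′ ⟨
    (k ∙ x) ∙ h′      ∎)
    where open ≡-Reasoning

  N-saturated : ∀ {A} → Saturated G H A → Saturated G H (N G H S A)
  N-saturated {A} A-sat {x} {h} x∈N h∈H with ∈N⁻ x∈N
  ... | x∉A , g , g∈A , s , s∈S , h₁ , h₁∈H , h₂ , h₂∈H , gh₁∙s≡xh₂ =
    ∈N⁺ (λ xh∈A → x∉A (subst (_∈ A) (//-rightDividesʳ h x) (A-sat xh∈A (H-⁻¹-closed h∈H)))) g∈A
        (s , s∈S , h₁ , h₁∈H , h ⁻¹ ∙ h₂ , H-∙-closed (H-⁻¹-closed h∈H) h₂∈H ,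
         trans gh₁∙s≡xh₂ (trans (cong (x ∙_) (sym (\\-leftDividesˡ h h₂))) (sym (assoc _ _ _))))

  Reach-closed : ∀ {A} → Saturated G H A → ∀ {u v} → Reach G H S (N G H S A) u v → u ∈ A → v ∈ A
  Reach-closed {A} A-sat {u} {v} (same u⁻¹v∈H) u∈A = subst (_∈ A) (\\-leftDividesˡ u v) (A-sat u∈A u⁻¹v∈H)
  Reach-closed {A} A-sat (step {w = w} e w∉N r) u∈A with w ∈? A
  ... | yes w∈A = Reach-closed A-sat r w∈A
  ... | no  w∉A = contradiction (∈N⁺ w∉A u∈A e) w∉N

  N-disconnects : ∀ {A x y} → Saturated G H A → x ∈ A → y ∉ A → y ∉ N G H S A → Disconnects G H S (N G H S A)
  N-disconnects A-sat x∈A y∉A y∉N =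
    _ , _ , (λ x∈N → proj₁ (∈N⁻ x∈N) x∈A) , y∉N , λ r → y∉A (Reach-closed A-sat r x∈A)

  module _ {A B : Subset m} {x : Fin m} where
    ∈N[A∩B]⁻ : x ∈ N G H S (A ∩ B) → (x ∈ A × x ∈ N G H S B) ⊎ (x ∈ N G H S A × (x ∈ B ⊎ x ∈ N G H S B))
    ∈N[A∩B]⁻ x∈N with ∈N⁻ x∈N
    ... | x∉A∩B , g , g∈A∩B , e with x∈p∩q⁻ A B g∈A∩B | x ∈? A | x ∈? B
    ... | _       , _   | yes x∈A | yes x∈B = contradiction (x∈p∩q⁺ (x∈A , x∈B)) x∉A∩B
    ... | _       , g∈B | yes x∈A | no  x∉B = inj₁ (x∈A , ∈N⁺ x∉B g∈B e)
    ... | g∈A     , _   | no  x∉A | yes x∈B = inj₂ (∈N⁺ x∉A g∈A e , inj₁ x∈B)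
    ... | g∈A     , g∈B | no  x∉A | no  x∉B = inj₂ (∈N⁺ x∉A g∈A e , inj₂ (∈N⁺ x∉B g∈B e))

    ∈N[A∪B]⁻ : x ∈ N G H S (A ∪ B) → x ∉ A × x ∉ B × (x ∈ N G H S A ⊎ x ∈ N G H S B)
    ∈N[A∪B]⁻ x∈N with ∈N⁻ x∈N
    ... | x∉A∪B , g , g∈A∪B , e = x∉A , x∉B , Data.Sum.map (λ g∈A → ∈N⁺ x∉A g∈A e) (λ g∈B → ∈N⁺ x∉B g∈B e) (x∈p∪q⁻ A B g∈A∪B)
      where
      x∉A : x ∉ A
      x∉A x∈A = x∉A∪B (x∈p∪q⁺ (inj₁ x∈A))
      x∉B : x ∉ B
      x∉B x∈B = x∉A∪B (x∈p∪q⁺ (inj₂ x∈B))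

  ∣N[A∩B]∣+∣N[A∪B]∣≤∣N[A]∣+∣N[B]∣ : ∀ A B →
    ∣ N G H S (A ∩ B) ∣ + ∣ N G H S (A ∪ B) ∣ ≤ ∣ N G H S A ∣ + ∣ N G H S B ∣
  ∣N[A∩B]∣+∣N[A∪B]∣≤∣N[A]∣+∣N[B]∣ A B = begin
    ∣ N∩ ∣ + ∣ N∪ ∣              ≡⟨ ∣p∣+∣q∣≡∣p∪q∣+∣p∩q∣ N∩ N∪ ⟩
    ∣ N∩ ∪ N∪ ∣ + ∣ N∩ ∩ N∪ ∣    ≤⟨ +-mono-≤ (p⊆q⇒∣p∣≤∣q∣ ∪-⊆) (p⊆q⇒∣p∣≤∣q∣ ∩-⊆) ⟩
    ∣ NA ∪ NB ∣ + ∣ NA ∩ NB ∣    ≡⟨ ∣p∣+∣q∣≡∣p∪q∣+∣p∩q∣ NA NB ⟨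
    ∣ NA ∣ + ∣ NB ∣              ∎
    where
    open ≤-Reasoning
    N∩ N∪ NA NB : Subset m
    N∩ = N G H S (A ∩ B)
    N∪ = N G H S (A ∪ B)
    NA = N G H S A
    NB = N G H S B
    ∪-⊆ : N∩ ∪ N∪ ⊆ NA ∪ NB
    ∪-⊆ x∈ with x∈p∪q⁻ N∩ N∪ x∈
    ... | inj₁ x∈N∩ with ∈N[A∩B]⁻ x∈N∩
    ...   | inj₁ (_ , x∈NB) = x∈p∪q⁺ (inj₂ x∈NB)
    ...   | inj₂ (x∈NA , _) = x∈p∪q⁺ (inj₁ x∈NA)
    ∪-⊆ x∈ | inj₂ x∈N∪ = x∈p∪q⁺ (proj₂ (proj₂ (∈N[A∪B]⁻ x∈N∪)))
    ∩-⊆ : N∩ ∩ N∪ ⊆ NA ∩ NB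
    ∩-⊆ x∈ with x∈p∩q⁻ N∩ N∪ x∈
    ... | x∈N∩ , x∈N∪ with ∈N[A∩B]⁻ x∈N∩ | ∈N[A∪B]⁻ x∈N∪
    ...   | inj₁ (x∈A , _)           | x∉A , _ = contradiction x∈A x∉A
    ...   | inj₂ (_ , inj₁ x∈B)      | _ , x∉B , _ = contradiction x∈B x∉B
    ...   | inj₂ (x∈NA , inj₂ x∈NB)  | _ = x∈p∩q⁺ (x∈NA , x∈NB)

  ∈N[g◃A]⇒g⁻¹x∈N[A] : ∀ g {A x} → x ∈ N G H S (g ◃ A) → g ⁻¹ ∙ x ∈ N G H S A
  ∈N[g◃A]⇒g⁻¹x∈N[A] g x∈N with ∈N⁻ x∈N
  ... | x∉gA , a , a∈gA , e = ∈N⁺ (λ g⁻¹x∈A → x∉gA (∈◃⁺ g⁻¹x∈A)) (∈◃⁻ a∈gA) (Edge-translate (g ⁻¹) e)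

  ∣N[g◃A]∣≤∣N[A]∣ : ∀ g A → ∣ N G H S (g ◃ A) ∣ ≤ ∣ N G H S A ∣
  ∣N[g◃A]∣≤∣N[A]∣ g A = injection⇒∣p∣≤∣q∣ (g ⁻¹ ∙_) (∈N[g◃A]⇒g⁻¹x∈N[A] g) (λ _ _ → ∙-cancelˡ _ _ _)

  kA≡A⇒kN[A]⊆N[A] : ∀ {A} k → (∀ {a} → a ∈ A → k ∙ a ∈ A) → (∀ {a} → k ∙ a ∈ A → a ∈ A) →
    ∀ {x} → x ∈ N G H S A → k ∙ x ∈ N G H S A
  kA≡A⇒kN[A]⊆N[A] k kA⊆A k⁻¹A⊆A x∈N with ∈N⁻ x∈N
  ... | x∉A , a , a∈A , e = ∈N⁺ (λ kx∈A → x∉A (k⁻¹A⊆A kx∈A)) (kA⊆A a∈A) (Edge-translate k e)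

  module _ {S′ A : Subset m} {x : Fin m} where
    ∈ProdSH⁺ : ∀ {a s h} → a ∈ A → s ∈ S′ → h ∈ H → (a ∙ s) ∙ h ≡ x → x ∈ ProdSH G H S′ A
    ∈ProdSH⁺ a∈A s∈S′ h∈H eq =
      ∈toSub⁺ (λ x → any? λ a → (a ∈? A) ×-dec any? λ s → (s ∈? S′) ×-dec
                      any? λ h → (h ∈? H) ×-dec ((a ∙ s) ∙ h ≟ x))
              (_ , a∈A , _ , s∈S′ , _ , h∈H , eq)

    ∈ProdSH⁻ : x ∈ ProdSH G H S′ A → ∃ λ a → a ∈ A × ∃ λ s → s ∈ S′ × ∃ λ h → h ∈ H × (a ∙ s) ∙ h ≡ x
    ∈ProdSH⁻ = ∈toSub⁻ (λ x → any? λ a → (a ∈? A) ×-dec any? λ s → (s ∈? S′) ×-dec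
                                any? λ h → (h ∈? H) ×-dec ((a ∙ s) ∙ h ≟ x))

  module _ {s x : Fin m} where
    ∈DC⁺ : ∀ {h h′} → h ∈ H → h′ ∈ H → (h ∙ s) ∙ h′ ≡ x → x ∈ DC G H s
    ∈DC⁺ h∈H h′∈H eq = ∈toSub⁺ (λ x → any? λ h → (h ∈? H) ×-dec any? λ h′ → (h′ ∈? H) ×-dec ((h ∙ s) ∙ h′ ≟ x))
                               (_ , h∈H , _ , h′∈H , eq)

    ∈DC⁻ : x ∈ DC G H s → ∃ λ h → h ∈ H × ∃ λ h′ → h′ ∈ H × (h ∙ s) ∙ h′ ≡ x
    ∈DC⁻ = ∈toSub⁻ (λ x → any? λ h → (h ∈? H) ×-dec any? λ h′ → (h′ ∈? H) ×-dec ((h ∙ s) ∙ h′ ≟ x))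

  DC-saturated : ∀ s → Saturated G H (DC G H s)
  DC-saturated s {x} {h} x∈ h∈H with ∈DC⁻ x∈
  ... | h₁ , h₁∈H , h₂ , h₂∈H , eq = ∈DC⁺ h₁∈H (H-∙-closed h₂∈H h∈H) (trans (sym (assoc _ _ _)) (cong (_∙ h) eq))

  DC-sym : ∀ {s x} → x ∈ DC G H s → s ∈ DC G H x
  DC-sym {s} {x} x∈ with ∈DC⁻ x∈
  ... | h , h∈H , h′ , h′∈H , hs∙h′≡x = ∈DC⁺ (H-⁻¹-closed h∈H) (H-⁻¹-closed h′∈H) (begin
    (h ⁻¹ ∙ x) ∙ h′ ⁻¹ ≡⟨ assoc _ _ _ ⟩
    h ⁻¹ ∙ (x ∙ h′ ⁻¹) ≡⟨ cong (λ y → h ⁻¹ ∙ (y ∙ h′ ⁻¹)) hs∙h′≡x ⟨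
    h ⁻¹ ∙ (((h ∙ s) ∙ h′) ∙ h′ ⁻¹) ≡⟨ cong (h ⁻¹ ∙_) (//-rightDividesʳ h′ (h ∙ s)) ⟩
    h ⁻¹ ∙ (h ∙ s)     ≡⟨ \\-leftDividesʳ h s ⟩
    s                  ∎)
    where open ≡-Reasoning

  DC-trans : ∀ {s t x} → x ∈ DC G H s → s ∈ DC G H t → x ∈ DC G H t
  DC-trans {s} {t} {x} x∈ s∈ with ∈DC⁻ x∈ | ∈DC⁻ s∈
  ... | h , h∈H , h′ , h′∈H , hs∙h′≡x | k , k∈H , k′ , k′∈H , kt∙k′≡s =
    ∈DC⁺ (H-∙-closed h∈H k∈H) (H-∙-closed k′∈H h′∈H) (begin
    ((h ∙ k) ∙ t) ∙ (k′ ∙ h′) ≡⟨ cong (_∙ (k′ ∙ h′)) (assoc h k t) ⟩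
    (h ∙ (k ∙ t)) ∙ (k′ ∙ h′) ≡⟨ assoc h (k ∙ t) (k′ ∙ h′) ⟩
    h ∙ ((k ∙ t) ∙ (k′ ∙ h′)) ≡⟨ cong (h ∙_) (assoc (k ∙ t) k′ h′) ⟨
    h ∙ (((k ∙ t) ∙ k′) ∙ h′) ≡⟨ cong (λ y → h ∙ (y ∙ h′)) kt∙k′≡s ⟩
    h ∙ (s ∙ h′)              ≡⟨ assoc h s h′ ⟨
    (h ∙ s) ∙ h′              ≡⟨ hs∙h′≡x ⟩
    x                         ∎)
    where open ≡-Reasoning

  DC-overlap⇒≡ : ∀ {s t x} → x ∈ DC G H s → x ∈ DC G H t → DC G H s ≡ DC G H t
  DC-overlap⇒≡ x∈Ds x∈Dt = ⊆-antisym
    (λ y∈Ds → DC-trans y∈Ds (DC-trans (DC-sym x∈Ds) x∈Dt))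
    (λ y∈Dt → DC-trans y∈Dt (DC-trans (DC-sym x∈Dt) x∈Ds))

  Σd*∣H∣≤∣T∣ : ∀ {k} (bs : Vec Bool k) (f : Fin k → Fin m) {T : Subset m} →
    (∀ {i} → i ∈ bs → DC G H (f i) ⊆ T) →
    (∀ {i j x} → i ∈ bs → j ∈ bs → x ∈ DC G H (f i) → x ∈ DC G H (f j) → i ≡ j) →
    Vec.sum (zipWith (λ b s → if b then d G H s else 0) bs (tabulate f)) * ∣ H ∣ ≤ ∣ T ∣
  Σd*∣H∣≤∣T∣ []           f _ _ = z≤n
  Σd*∣H∣≤∣T∣ (false ∷ bs) f D⊆T disjoint =
    Σd*∣H∣≤∣T∣ bs (f ∘ suc) (D⊆T ∘ there) (λ i∈ j∈ x∈ x∈′ → suc-injective (disjoint (there i∈) (there j∈) x∈ x∈′))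
  Σd*∣H∣≤∣T∣ (true ∷ bs)  f {T} D⊆T disjoint = begin
    (d G H (f zero) + rest) * ∣ H ∣          ≡⟨ *-distribʳ-+ ∣ H ∣ (d G H (f zero)) rest ⟩
    d G H (f zero) * ∣ H ∣ + rest * ∣ H ∣    ≡⟨ cong (_+ rest * ∣ H ∣) (∣X∣≡#V[X]*∣H∣ (DC-saturated (f zero))) ⟨
    ∣ D₀ ∣ + rest * ∣ H ∣                    ≤⟨ +-mono-≤ (p⊆q⇒∣p∣≤∣q∣ (λ x∈ → x∈p∩q⁺ (D⊆T here x∈ , x∈)))
                                                        (Σd*∣H∣≤∣T∣ bs (f ∘ suc) D⊆T∖D₀ disjoint′) ⟩
    ∣ T ∩ D₀ ∣ + ∣ T ∩ ∁ D₀ ∣                ≡⟨ ∣p∣≡∣p∩q∣+∣p∩∁q∣ T D₀ ⟨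
    ∣ T ∣                                    ∎
    where
    open ≤-Reasoning
    rest : ℕ
    rest = Vec.sum (zipWith (λ b s → if b then d G H s else 0) bs (tabulate (f ∘ suc)))
    D₀ : Subset m
    D₀ = DC G H (f zero)
    D⊆T∖D₀ : ∀ {i} → i ∈ bs → DC G H (f (suc i)) ⊆ T ∩ ∁ D₀
    D⊆T∖D₀ i∈ x∈ = x∈p∩q⁺ (D⊆T (there i∈) x∈ , x∉p⇒x∈∁p λ x∈D₀ → 0≢1+n (disjoint here (there i∈) x∈D₀ x∈))
    disjoint′ : ∀ {i j x} → i ∈ bs → j ∈ bs → x ∈ DC G H (f (suc i)) → x ∈ DC G H (f (suc j)) → i ≡ j
    disjoint′ i∈ j∈ x∈ x∈′ = suc-injective (disjoint (there i∈) (there j∈) x∈ x∈′)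

  dSum*∣H∣≤∣T∣ : ∀ {S′ T} → (∀ {s} → s ∈ S′ → DC G H s ⊆ T) →
    (∀ {s t x} → s ∈ S′ → t ∈ S′ → x ∈ DC G H s → x ∈ DC G H t → s ≡ t) →
    dSum G H S′ * ∣ H ∣ ≤ ∣ T ∣
  dSum*∣H∣≤∣T∣ {S′} = Σd*∣H∣≤∣T∣ S′ id

  module Atoms (κ : ℕ) (conn : IsConnectivity G H S κ) where

    κ≤#V[N[A]] : ∀ {A x y} → Saturated G H A → x ∈ A → y ∉ A → y ∉ N G H S A → κ ≤ #V G H (N G H S A)
    κ≤#V[N[A]] A-sat x∈A y∉A y∉N = proj₂ conn _ (N-saturated A-sat) (N-disconnects A-sat x∈A y∉A y∉N)

    atom-size-unique : ∀ {A B} → IsAtom G H S κ A → IsAtom G H S κ B → #V G H A ≡ #V G H B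
    atom-size-unique (A-part , N[A]≡κ , A-min) (B-part , N[B]≡κ , B-min) =
      ≤-antisym (A-min _ B-part N[B]≡κ) (B-min _ A-part N[A]≡κ)

    2#V[K]+κ≤#V[G] : ∀ {A K} → IsAtom G H S κ A → 2 * #V G H A ≤ #V G H ⊤ ∸ κ →
      IsAtom G H S κ K → 2 * #V G H K + κ ≤ #V G H ⊤
    2#V[K]+κ≤#V[G] {A} {K} A-atom A-small K-atom = begin
      2 * #V G H K + κ       ≡⟨ cong (λ a → 2 * a + κ) (atom-size-unique K-atom A-atom) ⟩
      2 * #V G H A + κ       ≤⟨ +-monoˡ-≤ κ A-small ⟩
      #V G H ⊤ ∸ κ + κ       ≡⟨ m∸n+n≡m κ≤#V[G] ⟩
      #V G H ⊤               ∎
      where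
      open ≤-Reasoning
      κ≤#V[G] : κ ≤ #V G H ⊤
      κ≤#V[G] = subst (_≤ #V G H ⊤) (proj₁ (proj₂ K-atom)) (#V-mono {N G H S K} (λ _ → ∈⊤))

    module SmallAtom {K : Subset m} (K-atom : IsAtom G H S κ K) (K-small : 2 * #V G H K + κ ≤ #V G H ⊤) where
      private
        K-sat : Saturated G H K
        K-sat = proj₁ (proj₁ K-atom)
        x₀ : Fin m
        x₀ = proj₁ (proj₂ (proj₁ K-atom))
        x₀∉K : x₀ ∉ K
        x₀∉K = proj₁ (proj₂ (proj₂ (proj₁ K-atom)))
        x₀∉N[K] : x₀ ∉ N G H S K
        x₀∉N[K] = proj₂ (proj₂ (proj₂ (proj₁ K-atom)))
        #V[N[K]]≡κ : #V G H (N G H S K) ≡ κ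
        #V[N[K]]≡κ = proj₁ (proj₂ K-atom)

      ∣N[K]∣≡κ*∣H∣ : ∣ N G H S K ∣ ≡ κ * ∣ H ∣
      ∣N[K]∣≡κ*∣H∣ = trans (∣X∣≡#V[X]*∣H∣ {N G H S K} (N-saturated K-sat)) (cong (_* ∣ H ∣) #V[N[K]]≡κ)

      ∣N[K]∣≤∣N[A]∣ : ∀ {A x y} → Saturated G H A → x ∈ A → y ∉ A → y ∉ N G H S A →
        ∣ N G H S K ∣ ≤ ∣ N G H S A ∣
      ∣N[K]∣≤∣N[A]∣ {A} A-sat x∈A y∉A y∉N = begin
        ∣ N G H S K ∣               ≡⟨ ∣N[K]∣≡κ*∣H∣ ⟩
        κ * ∣ H ∣                   ≤⟨ *-monoˡ-≤ ∣ H ∣ (κ≤#V[N[A]] A-sat x∈A y∉A y∉N) ⟩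
        #V G H (N G H S A) * ∣ H ∣  ≡⟨ ∣X∣≡#V[X]*∣H∣ (N-saturated A-sat) ⟨
        ∣ N G H S A ∣               ∎
        where open ≤-Reasoning

      ∣K∣≤∣A∣ : ∀ {A} → IsPart G H S A → ∣ N G H S A ∣ ≡ ∣ N G H S K ∣ → ∣ K ∣ ≤ ∣ A ∣
      ∣K∣≤∣A∣ {A} A-part ∣N[A]∣≡∣N[K]∣ = begin
        ∣ K ∣             ≡⟨ ∣X∣≡#V[X]*∣H∣ K-sat ⟩
        #V G H K * ∣ H ∣  ≤⟨ *-monoˡ-≤ ∣ H ∣ (proj₂ (proj₂ K-atom) A A-part #V[N[A]]≡κ) ⟩
        #V G H A * ∣ H ∣  ≡⟨ ∣X∣≡#V[X]*∣H∣ (proj₁ A-part) ⟨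
        ∣ A ∣             ∎
        where
        open ≤-Reasoning
        #V[N[A]]≡κ : #V G H (N G H S A) ≡ κ
        #V[N[A]]≡κ = trans (cong (_// ∣ H ∣) ∣N[A]∣≡∣N[K]∣) #V[N[K]]≡κ

      ∣K∣+∣K∣+∣N[K]∣≤∣G∣ : ∣ K ∣ + (∣ K ∣ + ∣ N G H S K ∣) ≤ m
      ∣K∣+∣K∣+∣N[K]∣≤∣G∣ = begin
        ∣ K ∣ + (∣ K ∣ + ∣ N G H S K ∣)                   ≡⟨ cong₂ (λ a b → a + (a + b)) (∣X∣≡#V[X]*∣H∣ K-sat) ∣N[K]∣≡κ*∣H∣ ⟩
        #V G H K * ∣ H ∣ + (#V G H K * ∣ H ∣ + κ * ∣ H ∣) ≡⟨ distrib (#V G H K) κ ∣ H ∣ ⟩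
        (2 * #V G H K + κ) * ∣ H ∣                        ≤⟨ *-monoˡ-≤ ∣ H ∣ K-small ⟩
        #V G H ⊤ * ∣ H ∣                                  ≡⟨ ∣X∣≡#V[X]*∣H∣ (λ _ _ → ∈⊤) ⟨
        ∣ ⊤ {m} ∣                                         ≡⟨ ∣⊤∣≡n m ⟩
        m                                                 ∎
        where
        open ≤-Reasoning
        distrib : ∀ a k c → a * c + (a * c + k * c) ≡ (2 * a + k) * c
        distrib = solve-∀

      module _ {B : Subset m} (B-sat : Saturated G H B) (∣B∣≤∣K∣ : ∣ B ∣ ≤ ∣ K ∣)
               (∣N[B]∣≤∣N[K]∣ : ∣ N G H S B ∣ ≤ ∣ N G H S K ∣) {z : Fin m} (z∈K∩B : z ∈ K ∩ B) where
        private
          P Q : Subset m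
          P = N G H S K
          Q = N G H S B

          C-sat : Saturated G H (K ∩ B)
          C-sat x∈C h∈H with x∈p∩q⁻ K B x∈C
          ... | x∈K , x∈B = x∈p∩q⁺ (K-sat x∈K h∈H , B-sat x∈B h∈H)

          x₀∉C : x₀ ∉ K ∩ B
          x₀∉C x₀∈C = x₀∉K (proj₁ (x∈p∩q⁻ K B x₀∈C))

          x₀∉N[C] : x₀ ∉ N G H S (K ∩ B)
          x₀∉N[C] x₀∈N with ∈N⁻ x₀∈N
          ... | _ , g , g∈C , e = x₀∉N[K] (∈N⁺ x₀∉K (proj₁ (x∈p∩q⁻ K B g∈C)) e)

          ∣P∣≤∣N[C]∣ : ∣ P ∣ ≤ ∣ N G H S (K ∩ B) ∣
          ∣P∣≤∣N[C]∣ = ∣N[K]∣≤∣N[A]∣ C-sat z∈K∩B x₀∉C x₀∉N[C]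

          ∣N[C]∣≤∣P∣⇒K⊆B : ∣ N G H S (K ∩ B) ∣ ≤ ∣ P ∣ → K ⊆ B
          ∣N[C]∣≤∣P∣⇒K⊆B ∣N[C]∣≤∣P∣ = ∣p∣≤∣p∩q∣⇒p⊆q
            (∣K∣≤∣A∣ (C-sat , x₀ , x₀∉C , x₀∉N[C]) (≤-antisym ∣N[C]∣≤∣P∣ ∣P∣≤∣N[C]∣))

          -- a common exterior vertex makes K ∪ B a part; submodularity then bounds N(K ∩ B)
          exterior-case : ∀ {y} → y ∉ K ∪ P → y ∉ B ∪ Q → K ⊆ B
          exterior-case {y} y∉K∪P y∉B∪Q = ∣N[C]∣≤∣P∣⇒K⊆B (+-cancelʳ-≤ ∣ P ∣ _ _ (begin
            ∣ N G H S (K ∩ B) ∣ + ∣ P ∣                   ≤⟨ +-monoʳ-≤ _ (∣N[K]∣≤∣N[A]∣ D-sat z∈D y∉D y∉N[D]) ⟩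
            ∣ N G H S (K ∩ B) ∣ + ∣ N G H S (K ∪ B) ∣     ≤⟨ ∣N[A∩B]∣+∣N[A∪B]∣≤∣N[A]∣+∣N[B]∣ K B ⟩
            ∣ P ∣ + ∣ Q ∣                                 ≤⟨ +-monoʳ-≤ ∣ P ∣ ∣N[B]∣≤∣N[K]∣ ⟩
            ∣ P ∣ + ∣ P ∣                                 ∎))
            where
            open ≤-Reasoning
            z∈D : z ∈ K ∪ B
            z∈D = x∈p∪q⁺ (inj₁ (proj₁ (x∈p∩q⁻ K B z∈K∩B)))
            D-sat : Saturated G H (K ∪ B)
            D-sat x∈D h∈H with x∈p∪q⁻ K B x∈D
            ... | inj₁ x∈K = x∈p∪q⁺ (inj₁ (K-sat x∈K h∈H))
            ... | inj₂ x∈B = x∈p∪q⁺ (inj₂ (B-sat x∈B h∈H))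
            y∉D : y ∉ K ∪ B
            y∉D y∈D with x∈p∪q⁻ K B y∈D
            ... | inj₁ y∈K = y∉K∪P (x∈p∪q⁺ (inj₁ y∈K))
            ... | inj₂ y∈B = y∉B∪Q (x∈p∪q⁺ (inj₁ y∈B))
            y∉N[D] : y ∉ N G H S (K ∪ B)
            y∉N[D] y∈N with proj₂ (proj₂ (∈N[A∪B]⁻ y∈N))
            ... | inj₁ y∈P = y∉K∪P (x∈p∪q⁺ (inj₂ y∈P))
            ... | inj₂ y∈Q = y∉B∪Q (x∈p∪q⁺ (inj₂ y∈Q))

          -- otherwise the exterior of B lies in K ∪ N(K), and counting against the size of G
          -- forces K ∩ B = ∅
          covered-case : ∁ (B ∪ Q) ⊆ K ∪ P → ⊥
          covered-case ∁W⊆K∪P = contradiction ∣K∣+∣C∣≤∣K∣ (<⇒≱ (m<m+n ∣ K ∣ (x∈p⇒0<∣p∣ z∈K∩B)))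
            where
            W : Subset m
            W = B ∪ Q
            ∣N[C]∣≤ : ∣ N G H S (K ∩ B) ∣ ≤ ∣ K ∩ Q ∣ + ∣ P ∩ W ∣
            ∣N[C]∣≤ = p⊆q∪r⇒∣p∣≤∣q∣+∣r∣ _ (K ∩ Q) (P ∩ W) λ x∈N → x∈p∪q⁺ (Data.Sum.map
              (λ (x∈K , x∈Q) → x∈p∩q⁺ (x∈K , x∈Q))
              (λ (x∈P , x∈B⊎Q) → x∈p∩q⁺ (x∈P , x∈p∪q⁺ x∈B⊎Q)) (∈N[A∩B]⁻ {K} {B} x∈N))
            ∣P∩∁W∣≤∣K∩Q∣ : ∣ P ∩ ∁ W ∣ ≤ ∣ K ∩ Q ∣
            ∣P∩∁W∣≤∣K∩Q∣ = +-cancelˡ-≤ ∣ P ∩ W ∣ _ _ (begin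
              ∣ P ∩ W ∣ + ∣ P ∩ ∁ W ∣  ≡⟨ ∣p∣≡∣p∩q∣+∣p∩∁q∣ P W ⟨
              ∣ P ∣                    ≤⟨ ∣P∣≤∣N[C]∣ ⟩
              ∣ N G H S (K ∩ B) ∣      ≤⟨ ∣N[C]∣≤ ⟩
              ∣ K ∩ Q ∣ + ∣ P ∩ W ∣    ≡⟨ +-comm ∣ K ∩ Q ∣ _ ⟩
              ∣ P ∩ W ∣ + ∣ K ∩ Q ∣    ∎)
              where open ≤-Reasoning
            ∣∁W∣≤ : ∣ ∁ W ∣ ≤ ∣ K ∩ ∁ W ∣ + ∣ P ∩ ∁ W ∣
            ∣∁W∣≤ = p⊆q∪r⇒∣p∣≤∣q∣+∣r∣ (∁ W) (K ∩ ∁ W) (P ∩ ∁ W) λ x∈∁W → x∈p∪q⁺ (Data.Sum.map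
              (λ x∈K → x∈p∩q⁺ (x∈K , x∈∁W)) (λ x∈P → x∈p∩q⁺ (x∈P , x∈∁W))
              (x∈p∪q⁻ K P (∁W⊆K∪P x∈∁W)))
            ∣K∩Q∣+∣C∣≤∣K∩W∣ : ∣ K ∩ Q ∣ + ∣ K ∩ B ∣ ≤ ∣ K ∩ W ∣
            ∣K∩Q∣+∣C∣≤∣K∩W∣ = Empty[p∩q]⇒∣p∣+∣q∣≤∣r∣ (K ∩ Q) (K ∩ B) (K ∩ W)
              (λ (x , x∈) → let (x∈K∩Q , x∈K∩B) = x∈p∩q⁻ (K ∩ Q) (K ∩ B) x∈ in
                 proj₁ (∈N⁻ (proj₂ (x∈p∩q⁻ K Q x∈K∩Q))) (proj₂ (x∈p∩q⁻ K B x∈K∩B)))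
              (λ x∈ → Data.Sum.[ (λ x∈K∩Q → let (x∈K , x∈Q) = x∈p∩q⁻ K Q x∈K∩Q in x∈p∩q⁺ (x∈K , x∈p∪q⁺ (inj₂ x∈Q)))
                               , (λ x∈K∩B → let (x∈K , x∈B) = x∈p∩q⁻ K B x∈K∩B in x∈p∩q⁺ (x∈K , x∈p∪q⁺ (inj₁ x∈B))) ]′
                               (x∈p∪q⁻ (K ∩ Q) (K ∩ B) x∈))
            ∣K∣≤∣∁W∣ : ∣ K ∣ ≤ ∣ ∁ W ∣
            ∣K∣≤∣∁W∣ = +-cancelʳ-≤ (∣ K ∣ + ∣ P ∣) _ _ (begin
              ∣ K ∣ + (∣ K ∣ + ∣ P ∣)  ≤⟨ ∣K∣+∣K∣+∣N[K]∣≤∣G∣ ⟩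
              m                        ≡⟨ ∣p∣+∣∁p∣≡n W ⟨
              ∣ W ∣ + ∣ ∁ W ∣          ≡⟨ +-comm ∣ W ∣ _ ⟩
              ∣ ∁ W ∣ + ∣ W ∣          ≤⟨ +-monoʳ-≤ ∣ ∁ W ∣ (p⊆q∪r⇒∣p∣≤∣q∣+∣r∣ W B Q id) ⟩
              ∣ ∁ W ∣ + (∣ B ∣ + ∣ Q ∣) ≤⟨ +-monoʳ-≤ ∣ ∁ W ∣ (+-mono-≤ ∣B∣≤∣K∣ ∣N[B]∣≤∣N[K]∣) ⟩
              ∣ ∁ W ∣ + (∣ K ∣ + ∣ P ∣) ∎)
              where open ≤-Reasoning
            ∣K∣+∣C∣≤∣K∣ : ∣ K ∣ + ∣ K ∩ B ∣ ≤ ∣ K ∣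
            ∣K∣+∣C∣≤∣K∣ = begin
              ∣ K ∣ + ∣ K ∩ B ∣                               ≤⟨ +-monoˡ-≤ ∣ K ∩ B ∣ (≤-trans ∣K∣≤∣∁W∣ ∣∁W∣≤) ⟩
              ∣ K ∩ ∁ W ∣ + ∣ P ∩ ∁ W ∣ + ∣ K ∩ B ∣           ≤⟨ +-monoˡ-≤ ∣ K ∩ B ∣ (+-monoʳ-≤ ∣ K ∩ ∁ W ∣ ∣P∩∁W∣≤∣K∩Q∣) ⟩
              ∣ K ∩ ∁ W ∣ + ∣ K ∩ Q ∣ + ∣ K ∩ B ∣             ≡⟨ +-assoc (∣ K ∩ ∁ W ∣) (∣ K ∩ Q ∣) (∣ K ∩ B ∣) ⟩
              ∣ K ∩ ∁ W ∣ + (∣ K ∩ Q ∣ + ∣ K ∩ B ∣)           ≤⟨ +-monoʳ-≤ ∣ K ∩ ∁ W ∣ ∣K∩Q∣+∣C∣≤∣K∩W∣ ⟩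
              ∣ K ∩ ∁ W ∣ + ∣ K ∩ W ∣                         ≡⟨ +-comm (∣ K ∩ ∁ W ∣) (∣ K ∩ W ∣) ⟩
              ∣ K ∩ W ∣ + ∣ K ∩ ∁ W ∣                         ≡⟨ ∣p∣≡∣p∩q∣+∣p∩∁q∣ K W ⟨
              ∣ K ∣                                           ∎
              where open ≤-Reasoning

        K⊆B : K ⊆ B
        K⊆B with nonempty? (∁ ((K ∪ P) ∪ (B ∪ Q)))
        ... | yes (y , y∈) = exterior-case (λ y∈K∪P → y∉ (x∈p∪q⁺ (inj₁ y∈K∪P))) (λ y∈B∪Q → y∉ (x∈p∪q⁺ (inj₂ y∈B∪Q)))
          where
          y∉ : y ∉ (K ∪ P) ∪ (B ∪ Q)
          y∉ = x∈∁p⇒x∉p y∈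
        ... | no no-exterior = ⊥-elim (covered-case ∁W⊆K∪P)
          where
          ∁W⊆K∪P : ∁ (B ∪ Q) ⊆ K ∪ P
          ∁W⊆K∪P {y} y∈∁W with y ∈? (K ∪ P)
          ... | yes y∈K∪P = y∈K∪P
          ... | no  y∉K∪P = ⊥-elim (no-exterior (y , x∉p⇒x∈∁p λ y∈ →
                 Data.Sum.[ y∉K∪P , x∈∁p⇒x∉p y∈∁W ]′ (x∈p∪q⁻ (K ∪ P) (B ∪ Q) y∈)))

      module IdentityAtom (ε∈K : ε ∈ K) where
        private
          H⊆K : H ⊆ K
          H⊆K {h} h∈H = subst (_∈ K) (identityˡ h) (K-sat ε∈K h∈H)

          -- K meets its translate kK in k, so the intersection property gives K ⊆ kK
          k⁻¹x∈K : ∀ {k x} → k ∈ K → x ∈ K → k ⁻¹ ∙ x ∈ K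
          k⁻¹x∈K {k} k∈K x∈K = ∈◃⁻ (K⊆B kK-sat (≤-reflexive (∣g◃A∣≡∣A∣ k K)) (∣N[g◃A]∣≤∣N[A]∣ k K)
                                     (x∈p∩q⁺ (k∈K , ∈◃⁺ (subst (_∈ K) (sym (inverseˡ k)) ε∈K))) x∈K)
            where
            kK-sat : Saturated G H (k ◃ K)
            kK-sat y∈kK h∈H = ∈◃⁺ (subst (_∈ K) (assoc _ _ _) (K-sat (∈◃⁻ y∈kK) h∈H))

        K-subgroup : IsSubgroup G K
        K-subgroup = ε∈K , K-∙-closed , K-⁻¹-closed
          where
          K-⁻¹-closed : ∀ {k} → k ∈ K → k ⁻¹ ∈ K
          K-⁻¹-closed {k} k∈K = subst (_∈ K) (identityʳ (k ⁻¹)) (k⁻¹x∈K k∈K ε∈K)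
          K-∙-closed : ∀ {k x} → k ∈ K → x ∈ K → k ∙ x ∈ K
          K-∙-closed {k} {x} k∈K x∈K = subst (_∈ K) (cong (_∙ x) (⁻¹-involutive k)) (k⁻¹x∈K (K-⁻¹-closed k∈K) x∈K)

        N[K]≡ProdSH : N G H S K ≡ ProdSH G H (S ∩ ∁ K) K
        N[K]≡ProdSH = ⊆-antisym N⊆ProdSH ProdSH⊆N
          where
          N⊆ProdSH : N G H S K ⊆ ProdSH G H (S ∩ ∁ K) K
          N⊆ProdSH {x} x∈N with ∈N⁻ x∈N
          ... | x∉K , g , g∈K , s , s∈S , h , h∈H , h′ , h′∈H , gh∙s≡xh′ =
            ∈ProdSH⁺ (K-sat g∈K h∈H) (x∈p∩q⁺ (s∈S , x∉p⇒x∈∁p s∉K)) (H-⁻¹-closed h′∈H) gh∙s∙h′⁻¹≡x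
            where
            gh∙s∙h′⁻¹≡x : ((g ∙ h) ∙ s) ∙ h′ ⁻¹ ≡ x
            gh∙s∙h′⁻¹≡x = trans (cong (_∙ h′ ⁻¹) gh∙s≡xh′) (//-rightDividesʳ h′ x)
            s∉K : s ∉ K
            s∉K s∈K = x∉K (subst (_∈ K) gh∙s∙h′⁻¹≡x
              (K-sat (proj₁ (proj₂ K-subgroup) (K-sat g∈K h∈H) s∈K) (H-⁻¹-closed h′∈H)))
          ProdSH⊆N : ProdSH G H (S ∩ ∁ K) K ⊆ N G H S K
          ProdSH⊆N {x} x∈ with ∈ProdSH⁻ x∈
          ... | a , a∈K , s , s∈S₁ , h , h∈H , as∙h≡x with x∈p∩q⁻ S (∁ K) s∈S₁
          ... | s∈S , s∈∁K = ∈N⁺ x∉K a∈K (s , s∈S , ε , ε∈H , h ⁻¹ , H-⁻¹-closed h∈H , aε∙s≡xh⁻¹)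
            where
            as≡xh⁻¹ : a ∙ s ≡ x ∙ h ⁻¹
            as≡xh⁻¹ = trans (sym (//-rightDividesʳ h (a ∙ s))) (cong (_∙ h ⁻¹) as∙h≡x)
            aε∙s≡xh⁻¹ : (a ∙ ε) ∙ s ≡ x ∙ h ⁻¹
            aε∙s≡xh⁻¹ = trans (cong (_∙ s) (identityʳ a)) as≡xh⁻¹
            x∉K : x ∉ K
            x∉K x∈K = x∈∁p⇒x∉p s∈∁K (subst (_∈ K) (trans (cong (a ⁻¹ ∙_) (sym as≡xh⁻¹)) (\\-leftDividesʳ a s))
              (k⁻¹x∈K a∈K (K-sat x∈K (H-⁻¹-closed h∈H))))

        0<κ : (∀ g → Gen G H S g) → 0 < κ
        0<κ generated with any? (λ s → (s ∈? S) ×-dec ¬? (s ∈? K))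
        ... | yes (s , s∈S , s∉K) = n≢0⇒n>0 λ κ≡0 → <⇒≢ (x∈p⇒0<∣p∣ s∈N[K])
                (sym (trans ∣N[K]∣≡κ*∣H∣ (cong (_* ∣ H ∣) κ≡0)))
          where
          s∈N[K] : s ∈ N G H S K
          s∈N[K] = ∈N⁺ s∉K ε∈K (s , s∈S , ε , ε∈H , ε , ε∈H ,
                   trans (cong (_∙ s) (identityˡ ε)) (trans (identityˡ s) (sym (identityʳ s))))
        ... | no S⊈K = contradiction (Gen⊆ K-subgroup H⊆K S⊆K (generated x₀)) x₀∉K
          where
          S⊆K : S ⊆ K
          S⊆K {s} s∈S with s ∈? K
          ... | yes s∈K = s∈K
          ... | no  s∉K = contradiction (s , s∈S , s∉K) S⊈K

        #V[K]∣κ : #V G H K ∣ κ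
        #V[K]∣κ = *-cancelʳ-∣ ∣ H ∣ (subst₂ _∣_ (∣X∣≡#V[X]*∣H∣ K-sat) ∣N[K]∣≡κ*∣H∣
          (∣K∣∣∣X∣⇐KX⊆X K-subgroup (N G H S K) λ k∈K → kA≡A⇒kN[A]⊆N[A] _
            (proj₁ (proj₂ K-subgroup) k∈K)
            (λ {a} ka∈K → subst (_∈ K) (\\-leftDividesʳ _ a) (k⁻¹x∈K k∈K ka∈K))))

        dSum≤κ : (∀ {s t} → s ∈ S → t ∈ S → DC G H s ≡ DC G H t → s ≡ t) → dSum G H (S ∩ ∁ K) ≤ κ
        dSum≤κ distinct = *-cancelʳ-≤ _ κ ∣ H ∣
          (subst (dSum G H (S ∩ ∁ K) * ∣ H ∣ ≤_) ∣N[K]∣≡κ*∣H∣ (dSum*∣H∣≤∣T∣ DC⊆N[K] disjoint))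
          where
          DC⊆N[K] : ∀ {s} → s ∈ S ∩ ∁ K → DC G H s ⊆ N G H S K
          DC⊆N[K] s∈S₁ x∈DC with ∈DC⁻ x∈DC
          ... | h , h∈H , h′ , h′∈H , hs∙h′≡x = subst (_ ∈_) (sym N[K]≡ProdSH) (∈ProdSH⁺ (H⊆K h∈H) s∈S₁ h′∈H hs∙h′≡x)
          disjoint : ∀ {s t x} → s ∈ S ∩ ∁ K → t ∈ S ∩ ∁ K → x ∈ DC G H s → x ∈ DC G H t → s ≡ t
          disjoint s∈S₁ t∈S₁ x∈Ds x∈Dt =
            distinct (proj₁ (x∈p∩q⁻ S _ s∈S₁)) (proj₁ (x∈p∩q⁻ S _ t∈S₁)) (DC-overlap⇒≡ x∈Ds x∈Dt)

lemma13 : ∀ {m} (G : FinGroup m) (H S : Subset m) →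
    IsSubgroup G H →
    (∀ {s} → s ∈ S → s ∉ H) →
    (∀ {s t} → s ∈ S → t ∈ S → DC G H s ≡ DC G H t → s ≡ t) →
    (∀ g → Gen G H S g) →
    ∀ (n κ : ℕ) → n ≡ #V G H ⊤ → IsConnectivity G H S κ →
    ¬ Complete G H S →
    (∃ λ A → IsAtom G H S κ A × 2 * #V G H A ≤ n ∸ κ) →
    ∀ (A₀ : Subset m) → IsAtom G H S κ A₀ → FinGroup.ε G ∈ A₀ →
    let S₁ = S ∩ ∁ A₀
        NA₀ = #V G H (N G H S A₀)
    in NA₀ ≡ #V G H (ProdSH G H S₁ A₀)
       × #V G H A₀ ⊔ dSum G H S₁ ≤ NA₀
       × #V G H A₀ ∣ NA₀
lemma13 G H S H≤G _ distinct generated n κ refl conn _ (A , A-atom , A-small) A₀ A₀-atom ε∈A₀ =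
    cong (#V G H) N[K]≡ProdSH
  , subst (_ ≤_) (sym #V[N[A₀]]≡κ) (⊔-lub (∣⇒≤ ⦃ >-nonZero (0<κ generated) ⦄ #V[K]∣κ) (dSum≤κ distinct))
  , subst (_ ∣_) (sym #V[N[A₀]]≡κ) #V[K]∣κ
  where
  open CosetDigraph G H S H≤G
  open Atoms κ conn
  open SmallAtom A₀-atom (2#V[K]+κ≤#V[G] A-atom A-small A₀-atom)
  open IdentityAtom ε∈A₀
  #V[N[A₀]]≡κ : #V G H (N G H S A₀) ≡ κ
  #V[N[A₀]]≡κ = proj₁ (proj₂ A₀-atom)
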